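{- Let $\Delta$ be a simplicial complex, $k\ge 1$, and let $\gamma=\sum_f\lambda_f f$ ($\lambda_f\in\mathbb{Z}$) be a $k$-cycle of $\Delta$ that is not a boundary and has minimal vertex support, in the sense that no $k$-cycle homologous to $\gamma$ has vertex support of smaller cardinality. Let $\Delta'$ be the induced subcomplex of $\Delta$ on $\mathrm{vsupp}(\gamma)$, let $v\in\mathrm{vsupp}(\gamma)$, orient all faces using a total order of the vertices in which $v$ is last, and let $\gamma\cap\mathrm{lk}(v)=\sum_{f\ni v}\lambda_f(f-\{v\})$. Then $\gamma\cap\mathrm{lk}(v)$ is a $(k-1)$-cycle which is not a boundary in the link $\mathrm{lk}_{\Delta'}(v)$.
   Context: Chains and homology are simplicial with integer coefficients. The vertex support $\mathrm{vsupp}(C)$ of a chain $C$ is the set of vertices lying in some face having nonzero coefficient in $C$. The induced subcomplex on a vertex set $W$ consists of all faces of $\Delta$ contained in $W$. The link $\mathrm{lk}_{\Delta'}(v)=\{\sigma: v\notin\sigma,\ \sigma\cup\{v\}\in\Delta'\}$. -}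

module Defs where

open import Data.Nat using (ℕ; zero; suc; _<ᵇ_)
open import Data.Bool using (Bool; true; false; if_then_else_; _∧_; not)
open import Data.Integer using (ℤ; 0ℤ; 1ℤ; -_; _+_; _*_)
import Data.Integer as ℤ
open import Data.Fin using (Fin; zero; suc)
open import Data.Fin.Subset using (Subset; ⁅_⁆; _∪_; _⊆_; _∈_; _∉_; ∣_∣)
open import Data.Vec using (Vec; []; _∷_; lookup; tabulate)
open import Data.List using (List; []; _∷_; map; _++_)
open import Data.Bool.ListAction using (any)
open import Data.Product using (Σ; _×_; ∃)
open import Relation.Nullary using (¬_; does)
open import Relation.Binary.PropositionalEquality using (_≡_)

private variable n : ℕ

record SimplicialComplex (n : ℕ) : Set₁ where
  field
    face      : Subset n → Set
    downClosed : ∀ {σ τ} → τ ⊆ σ → face σ → face τ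
open SimplicialComplex public

Family : ℕ → Set₁
Family n = Subset n → Set

induced : SimplicialComplex n → Subset n → Family n
induced Δ W σ = face Δ σ × σ ⊆ W

link : Family n → Fin n → Family n
link K v σ = v ∉ σ × K (σ ∪ ⁅ v ⁆)

-- Integer chains: coefficient functions on (unoriented) vertex sets;
-- a face is oriented by the total order given by an injective ranking.
Chain : ℕ → Set
Chain n = Subset n → ℤ

∑ : (Fin n → ℤ) → ℤ
∑ {zero}  f = 0ℤ
∑ {suc n} f = f zero + ∑ (λ i → f (suc i))

neg1^ : ℕ → ℤ
neg1^ zero    = 1ℤ
neg1^ (suc m) = - neg1^ m

∑ℕ : (Fin n → ℕ) → ℕ
∑ℕ {zero}  f = 0
∑ℕ {suc n} f = f zero Data.Nat.+ ∑ℕ (λ i → f (suc i))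

below : (Fin n → ℕ) → Subset n → Fin n → ℕ
below rank τ w = ∑ℕ λ u → if lookup τ u ∧ (rank u <ᵇ rank w) then 1 else 0

-- Simplicial boundary w.r.t. the orientation given by rank:
-- ∂[v₀<…<v_k] = Σᵢ (-1)ⁱ [v₀…v̂ᵢ…v_k]; hence
-- (∂c)(τ) = Σ_{w ∉ τ} (-1)^{#{u∈τ : u<w}} c(τ ∪ {w}).
-- (Augmented: the empty face is included, i.e. reduced homology.)
∂ : (Fin n → ℕ) → Chain n → Chain n
∂ rank c τ = ∑ (λ w → if lookup τ w then 0ℤ
                      else neg1^ (below rank τ w) * c (τ ∪ ⁅ w ⁆))

IsChain : Family n → ℕ → Chain n → Set
IsChain K k c = ∀ σ → ¬ (c σ ≡ 0ℤ) → K σ × ∣ σ ∣ ≡ suc k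

IsCycle : (Fin n → ℕ) → Family n → ℕ → Chain n → Set
IsCycle rank K k c = IsChain K k c × (∀ τ → ∂ rank c τ ≡ 0ℤ)

IsBoundary : (Fin n → ℕ) → Family n → ℕ → Chain n → Set
IsBoundary rank K k c =
  Σ (Chain _) λ d → IsChain K (suc k) d × (∀ τ → ∂ rank d τ ≡ c τ)

allSubsets : List (Subset n)
allSubsets {zero}  = [] ∷ []
allSubsets {suc n} = map (true ∷_) allSubsets ++ map (false ∷_) allSubsets

vsupp : Chain n → Subset n
vsupp c = tabulate λ u →
  any (λ σ → lookup σ u ∧ not (does (c σ ℤ.≟ 0ℤ))) allSubsets

capLink : Chain n → Fin n → Chain n
capLink γ v τ = if lookup τ v then 0ℤ else γ (τ ∪ ⁅ v ⁆)

{-# OPTIONS --safe #-}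
module Submission where

-- Write γ ∩ lk(v) for capLink γ v and v * c for the cone over v of a chain c. Because v is
-- the last vertex, ∂ commutes with γ ↦ γ ∩ lk(v), so γ ∩ lk(v) is a cycle, and
-- ∂(v * c) = v * ∂c ± c whenever c avoids v. If d is a chain of lk(v) with ∂d = γ ∩ lk(v),
-- the cycle γ′ = γ + ∂(v * (-d)) is homologous to γ; on faces through v it equals
-- γ - v * (γ ∩ lk(v)) = 0, and elsewhere it is supported on faces of γ or of d. So the vertex
-- support of γ′ misses v and lies in that of γ, contradicting minimality.

open import Defs
import Algebra.Properties.Semiring.Sum as SemiringSum
open import Data.Bool using (true; false; not; _∧_; _∨_; if_then_else_; T)
open import Data.Bool.Properties using (∨-zeroʳ; ∨-identityʳ; T-≡; T-∧; T-not-≡)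
open import Data.Empty using (⊥-elim)
open import Data.Fin using (Fin; zero; suc; _≟_)
import Data.Fin.Properties as Fin
open import Data.Fin.Subset using (Subset; ⁅_⁆; _∪_; _∈_; _∉_; _⊆_; ∣_∣) renaming (_-_ to _∖_)
open import Data.Fin.Subset.Properties
  using (∪-assoc; ∪-comm; ∪-identityʳ; p─⊥≡p; p⊆p∪q; x∈p∧x≢y⇒x∈p-y; p⊆q⇒∣p∣≤∣q∣; x∈p⇒∣p-x∣<∣p∣)
open import Data.Integer using (ℤ; 0ℤ; +0; +[1+_]; -[1+_]; -_; _+_; _-_; _*_)
import Data.Integer as ℤ
import Data.Integer.Properties as ℤ
open import Data.Integer.Tactic.RingSolver using (solve-∀)
import Data.List.Membership.Propositional as List
open import Data.List.Membership.Propositional.Properties using (∈-map⁺; ∈-++⁺ˡ; ∈-++⁺ʳ)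
open import Data.List.Relation.Unary.Any using (here; satisfied)
open import Data.List.Relation.Unary.Any.Properties using (any⁺; any⁻)
open import Data.Nat using (ℕ; zero; suc; _≤_; _<_; _∸_; _<ᵇ_)
import Data.Nat as ℕ
open import Data.Nat.Properties
  using (≤-antisym; ≮⇒≥; <-asym; ≤∧≢⇒<; <⇒≱; ≤-<-trans; +-identityʳ; +-assoc; suc-injective;
         <ᵇ-reflects-<; +-commutativeSemigroup)
open import Data.Product using (_×_; _,_; proj₁; proj₂; ∃)
open import Data.Sum using (_⊎_; inj₁; inj₂)
open import Data.Vec using ([]; _∷_; lookup)
open import Data.Vec.Properties
  using (lookup-zipWith; lookup-replicate; tabulate∘lookup; tabulate-cong; lookup∘tabulate;
         []=⇒lookup; lookup⇒[]=)
open import Function using (_∘_)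
open import Function.Bundles using (Equivalence)
open import Function.Definitions using (Injective)
open import Relation.Nullary using (¬_; does; yes; no)
open import Relation.Nullary.Decidable using (dec-true; dec-false; decidable-stable)
open import Relation.Nullary.Reflects using (ofʸ; ofⁿ)
open import Relation.Binary.PropositionalEquality

open SemiringSum ℤ.+-*-semiring
  using (sum; sum-cong-≗; *-distribˡ-sum) renaming (∑-comm to sum-comm; ∑-distrib-+ to sum-distrib-+)
open import Algebra.Properties.CommutativeSemigroup +-commutativeSemigroup using (x∙yz≈y∙xz)

private variable
  n : ℕ
  p q σ : Subset n
  k : ℕ
  K K′ : Family n
  c : Chain n
  x y : Fin n

lookup-⁅⁆ : (x y : Fin n) → lookup ⁅ x ⁆ y ≡ does (y ≟ x)
lookup-⁅⁆ zero    zero    = refl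
lookup-⁅⁆ zero    (suc y) = lookup-replicate y false
lookup-⁅⁆ (suc x) zero    = refl
lookup-⁅⁆ (suc x) (suc y) = lookup-⁅⁆ x y

lookup-p∪⁅x⁆-x : ∀ (p : Subset n) x → lookup (p ∪ ⁅ x ⁆) x ≡ true
lookup-p∪⁅x⁆-x p x
  rewrite lookup-zipWith _∨_ x p ⁅ x ⁆ | lookup-⁅⁆ x x | dec-true (x ≟ x) refl = ∨-zeroʳ (lookup p x)

lookup-p∪⁅x⁆-y : ∀ (p : Subset n) → y ≢ x → lookup (p ∪ ⁅ x ⁆) y ≡ lookup p y
lookup-p∪⁅x⁆-y {y = y} {x} p y≢x
  rewrite lookup-zipWith _∨_ y p ⁅ x ⁆ | lookup-⁅⁆ x y | dec-false (y ≟ x) y≢x = ∨-identityʳ (lookup p y)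

lookup-p∪⁅x⁆-mono : ∀ (p : Subset n) x → lookup p y ≡ true → lookup (p ∪ ⁅ x ⁆) y ≡ true
lookup-p∪⁅x⁆-mono {y = y} p x y∈p rewrite lookup-zipWith _∨_ y p ⁅ x ⁆ | y∈p = refl

lookup-p∖x-x : ∀ (p : Subset n) x → lookup (p ∖ x) x ≡ false
lookup-p∖x-x (b ∷ p) zero = refl
lookup-p∖x-x (b ∷ p) (suc x) = lookup-p∖x-x p x

lookup-p∖x-y : ∀ (p : Subset n) → y ≢ x → lookup (p ∖ x) y ≡ lookup p y
lookup-p∖x-y {y = zero}  {zero}  (b ∷ p) y≢x = ⊥-elim (y≢x refl)
lookup-p∖x-y {y = suc y} {zero}  (b ∷ p) y≢x = cong (λ q → lookup q y) (p─⊥≡p p)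
lookup-p∖x-y {y = zero}  {suc x} (b ∷ p) y≢x = refl
lookup-p∖x-y {y = suc y} {suc x} (b ∷ p) y≢x = lookup-p∖x-y p (y≢x ∘ cong suc)

lookup-ext : (∀ x → lookup p x ≡ lookup q x) → p ≡ q
lookup-ext {p = p} {q} eq = trans (sym (tabulate∘lookup p)) (trans (tabulate-cong eq) (tabulate∘lookup q))

∣p∪⁅x⁆∣ : ∀ (p : Subset n) x → lookup p x ≡ false → ∣ p ∪ ⁅ x ⁆ ∣ ≡ suc ∣ p ∣
∣p∪⁅x⁆∣ (false ∷ p) zero    refl = cong suc (cong ∣_∣ (∪-identityʳ p))
∣p∪⁅x⁆∣ (true  ∷ p) (suc x) x∉p  = cong suc (∣p∪⁅x⁆∣ p x x∉p)
∣p∪⁅x⁆∣ (false ∷ p) (suc x) x∉p  = ∣p∪⁅x⁆∣ p x x∉p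

∪⁅x⁆∪⁅y⁆-comm : ∀ (p : Subset n) x y → (p ∪ ⁅ x ⁆) ∪ ⁅ y ⁆ ≡ (p ∪ ⁅ y ⁆) ∪ ⁅ x ⁆
∪⁅x⁆∪⁅y⁆-comm p x y = begin
  (p ∪ ⁅ x ⁆) ∪ ⁅ y ⁆  ≡⟨ ∪-assoc p ⁅ x ⁆ ⁅ y ⁆ ⟩
  p ∪ (⁅ x ⁆ ∪ ⁅ y ⁆)  ≡⟨ cong (p ∪_) (∪-comm ⁅ x ⁆ ⁅ y ⁆) ⟩
  p ∪ (⁅ y ⁆ ∪ ⁅ x ⁆)  ≡⟨ sym (∪-assoc p ⁅ y ⁆ ⁅ x ⁆) ⟩
  (p ∪ ⁅ y ⁆) ∪ ⁅ x ⁆  ∎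
  where open ≡-Reasoning

p∖x∪⁅x⁆ : ∀ (p : Subset n) x → lookup p x ≡ true → (p ∖ x) ∪ ⁅ x ⁆ ≡ p
p∖x∪⁅x⁆ p x x∈p = lookup-ext pointwise
  where
  pointwise : ∀ y → lookup ((p ∖ x) ∪ ⁅ x ⁆) y ≡ lookup p y
  pointwise y with y ≟ x
  ... | yes refl = trans (lookup-p∪⁅x⁆-x (p ∖ x) x) (sym x∈p)
  ... | no y≢x   = trans (lookup-p∪⁅x⁆-y (p ∖ x) y≢x) (lookup-p∖x-y p y≢x)

p∪⁅x⁆∖x : ∀ (p : Subset n) x → lookup p x ≡ false → (p ∪ ⁅ x ⁆) ∖ x ≡ p
p∪⁅x⁆∖x p x x∉p = lookup-ext pointwise
  where
  pointwise : ∀ y → lookup ((p ∪ ⁅ x ⁆) ∖ x) y ≡ lookup p y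
  pointwise y with y ≟ x
  ... | yes refl = trans (lookup-p∖x-x (p ∪ ⁅ x ⁆) x) (sym x∉p)
  ... | no y≢x   = trans (lookup-p∖x-y (p ∪ ⁅ x ⁆) y≢x) (lookup-p∪⁅x⁆-y p y≢x)

p∪⁅y⁆∖x : y ≢ x → (p ∪ ⁅ y ⁆) ∖ x ≡ (p ∖ x) ∪ ⁅ y ⁆
p∪⁅y⁆∖x {y = y} {x} {p} y≢x = lookup-ext pointwise
  where
  pointwise : ∀ z → lookup ((p ∪ ⁅ y ⁆) ∖ x) z ≡ lookup ((p ∖ x) ∪ ⁅ y ⁆) z
  pointwise z with z ≟ x | z ≟ y
  ... | yes refl | yes refl = ⊥-elim (y≢x refl)
  ... | yes refl | no z≢y = trans (lookup-p∖x-x (p ∪ ⁅ y ⁆) z)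
                              (sym (trans (lookup-p∪⁅x⁆-y (p ∖ z) z≢y) (lookup-p∖x-x p z)))
  ... | no z≢x | yes refl = trans (lookup-p∖x-y (p ∪ ⁅ z ⁆) z≢x)
                              (trans (lookup-p∪⁅x⁆-x p z) (sym (lookup-p∪⁅x⁆-x (p ∖ x) z)))
  ... | no z≢x | no z≢y = trans (lookup-p∖x-y (p ∪ ⁅ y ⁆) z≢x) (trans (lookup-p∪⁅x⁆-y p z≢y)
                              (sym (trans (lookup-p∪⁅x⁆-y (p ∖ x) z≢y) (lookup-p∖x-y p z≢x))))

∑≡sum : (f : Fin n → ℤ) → ∑ f ≡ sum f
∑≡sum {zero}  f = refl
∑≡sum {suc n} f = cong (f zero +_) (∑≡sum (f ∘ suc))

∑-cong : {f g : Fin n → ℤ} → (∀ i → f i ≡ g i) → ∑ f ≡ ∑ g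
∑-cong {zero}  eq = refl
∑-cong {suc n} eq = cong₂ _+_ (eq zero) (∑-cong (eq ∘ suc))

∑-zero : {f : Fin n → ℤ} → (∀ i → f i ≡ 0ℤ) → ∑ f ≡ 0ℤ
∑-zero {zero}  eq = refl
∑-zero {suc n} eq = cong₂ _+_ (eq zero) (∑-zero (eq ∘ suc))

∑-single : {f : Fin n → ℤ} (j : Fin n) → (∀ i → i ≢ j → f i ≡ 0ℤ) → ∑ f ≡ f j
∑-single {f = f} zero    eq =
  trans (cong (f zero +_) (∑-zero (λ i → eq (suc i) λ ()))) (ℤ.+-identityʳ (f zero))
∑-single {f = f} (suc j) eq = begin
  f zero + ∑ (f ∘ suc)  ≡⟨ cong (_+ ∑ (f ∘ suc)) (eq zero λ ()) ⟩
  0ℤ + ∑ (f ∘ suc)      ≡⟨ ℤ.+-identityˡ _ ⟩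
  ∑ (f ∘ suc)           ≡⟨ ∑-single j (λ i i≢j → eq (suc i) (i≢j ∘ Fin.suc-injective)) ⟩
  f (suc j)             ∎
  where open ≡-Reasoning

∑-neg : (f : Fin n → ℤ) → ∑ (λ i → - f i) ≡ - ∑ f
∑-neg {zero}  f = refl
∑-neg {suc n} f = trans (cong (- f zero +_) (∑-neg (f ∘ suc))) (sym (ℤ.neg-distrib-+ (f zero) _))

∑-distrib-+ : (f g : Fin n → ℤ) → ∑ (λ i → f i + g i) ≡ ∑ f + ∑ g
∑-distrib-+ f g = begin
  ∑ (λ i → f i + g i)  ≡⟨ ∑≡sum (λ i → f i + g i) ⟩
  sum (λ i → f i + g i) ≡⟨ sum-distrib-+ f g ⟩
  sum f + sum g         ≡⟨ sym (cong₂ _+_ (∑≡sum f) (∑≡sum g)) ⟩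
  ∑ f + ∑ g             ∎
  where open ≡-Reasoning

*-distribˡ-∑ : ∀ a (f : Fin n → ℤ) → a * ∑ f ≡ ∑ (λ i → a * f i)
*-distribˡ-∑ a f = begin
  a * ∑ f              ≡⟨ cong (a *_) (∑≡sum f) ⟩
  a * sum f            ≡⟨ *-distribˡ-sum a f ⟩
  sum (λ i → a * f i)  ≡⟨ sym (∑≡sum (λ i → a * f i)) ⟩
  ∑ (λ i → a * f i)    ∎
  where open ≡-Reasoning

∑-comm : ∀ {m} (f : Fin m → Fin n → ℤ) → ∑ (λ i → ∑ (f i)) ≡ ∑ (λ j → ∑ (λ i → f i j))
∑-comm f = begin
  ∑ (λ i → ∑ (f i))                ≡⟨ ∑≡sum (λ i → ∑ (f i)) ⟩
  sum (λ i → ∑ (f i))              ≡⟨ sum-cong-≗ (∑≡sum ∘ f) ⟩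
  sum (λ i → sum (f i))            ≡⟨ sum-comm f ⟩
  sum (λ j → sum (λ i → f i j))    ≡⟨ sym (sum-cong-≗ (λ j → ∑≡sum (λ i → f i j))) ⟩
  sum (λ j → ∑ (λ i → f i j))      ≡⟨ sym (∑≡sum (λ j → ∑ (λ i → f i j))) ⟩
  ∑ (λ j → ∑ (λ i → f i j))        ∎
  where open ≡-Reasoning

∑ℕ-cong : {f g : Fin n → ℕ} → (∀ i → f i ≡ g i) → ∑ℕ f ≡ ∑ℕ g
∑ℕ-cong {zero}  eq = refl
∑ℕ-cong {suc n} eq = cong₂ ℕ._+_ (eq zero) (∑ℕ-cong (eq ∘ suc))

∑ℕ-bump : {f g : Fin n → ℕ} (j : Fin n) (b : ℕ) →
          (∀ i → i ≢ j → g i ≡ f i) → g j ≡ b ℕ.+ f j → ∑ℕ g ≡ b ℕ.+ ∑ℕ f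
∑ℕ-bump {f = f} zero b off at = trans (cong₂ ℕ._+_ at (∑ℕ-cong λ i → off (suc i) λ ()))
                                      (+-assoc b (f zero) (∑ℕ (f ∘ suc)))
∑ℕ-bump {f = f} (suc j) b off at =
  trans (cong₂ ℕ._+_ (off zero λ ()) (∑ℕ-bump j b (λ i i≢j → off (suc i) (i≢j ∘ Fin.suc-injective)) at))
        (x∙yz≈y∙xz (f zero) b (∑ℕ (f ∘ suc)))

-- The boundary operator

sgn : (Fin n → ℕ) → Subset n → Fin n → ℤ
sgn rank τ w = neg1^ (below rank τ w)

∂-term : (Fin n → ℕ) → Chain n → Subset n → Fin n → ℤ
∂-term rank c τ w = if lookup τ w then 0ℤ else sgn rank τ w * c (τ ∪ ⁅ w ⁆)

∂-+ : ∀ rank (c c′ : Chain n) τ → ∂ rank (λ σ → c σ + c′ σ) τ ≡ ∂ rank c τ + ∂ rank c′ τ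
∂-+ rank c c′ τ = trans (∑-cong term) (∑-distrib-+ (∂-term rank c τ) (∂-term rank c′ τ))
  where
  term : ∀ w → ∂-term rank (λ σ → c σ + c′ σ) τ w ≡ ∂-term rank c τ w + ∂-term rank c′ τ w
  term w with lookup τ w
  ... | true  = refl
  ... | false = ℤ.*-distribˡ-+ (sgn rank τ w) _ _

∂-neg : ∀ rank (c : Chain n) τ → ∂ rank (λ σ → - c σ) τ ≡ - ∂ rank c τ
∂-neg rank c τ = trans (∑-cong term) (∑-neg (∂-term rank c τ))
  where
  term : ∀ w → ∂-term rank (λ σ → - c σ) τ w ≡ - ∂-term rank c τ w
  term w with lookup τ w
  ... | true  = refl
  ... | false = sym (ℤ.neg-distribʳ-* (sgn rank τ w) _)

below-∪⁅⁆ : ∀ (rank : Fin n → ℕ) τ w u → lookup τ w ≡ false →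
            below rank (τ ∪ ⁅ w ⁆) u ≡ (if rank w <ᵇ rank u then 1 else 0) ℕ.+ below rank τ u
below-∪⁅⁆ rank τ w u w∉τ = ∑ℕ-bump w _ off at
  where
  counts : Subset _ → Fin _ → ℕ
  counts σ i = if lookup σ i ∧ (rank i <ᵇ rank u) then 1 else 0
  off : ∀ i → i ≢ w → counts (τ ∪ ⁅ w ⁆) i ≡ counts τ i
  off i i≢w rewrite lookup-p∪⁅x⁆-y τ i≢w = refl
  at : counts (τ ∪ ⁅ w ⁆) w ≡ (if rank w <ᵇ rank u then 1 else 0) ℕ.+ counts τ w
  at rewrite lookup-p∪⁅x⁆-x τ w | w∉τ = sym (+-identityʳ _)

<ᵇ-flip : ∀ {m n} → m ≢ n → (n <ᵇ m) ≡ not (m <ᵇ n)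
<ᵇ-flip {m} {n} m≢n with m <ᵇ n | <ᵇ-reflects-< m n | n <ᵇ m | <ᵇ-reflects-< n m
... | true  | ofʸ m<n  | true  | ofʸ n<m  = ⊥-elim (<-asym m<n n<m)
... | true  | ofʸ _    | false | ofⁿ _    = refl
... | false | ofⁿ _    | true  | ofʸ _    = refl
... | false | ofⁿ m≮n  | false | ofⁿ n≮m  = ⊥-elim (m≢n (≤-antisym (≮⇒≥ n≮m) (≮⇒≥ m≮n)))

-- Exactly one of w, u precedes the other, so exactly one of the two counts below them gains 1.
sgn-swap : ∀ (rank : Fin n → ℕ) τ w u → rank w ≢ rank u → lookup τ w ≡ false → lookup τ u ≡ false →
           ∀ x → sgn rank τ w * (sgn rank (τ ∪ ⁅ w ⁆) u * x) ≡ - (sgn rank τ u * (sgn rank (τ ∪ ⁅ u ⁆) w * x))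
sgn-swap rank τ w u rw≢ru w∉τ u∉τ
  rewrite below-∪⁅⁆ rank τ w u w∉τ | below-∪⁅⁆ rank τ u w u∉τ | <ᵇ-flip rw≢ru
  with rank w <ᵇ rank u
... | true  = λ x → w-first (sgn rank τ w) (sgn rank τ u) x
  where
  w-first : ∀ a b x → a * (- b * x) ≡ - (b * (a * x))
  w-first = solve-∀
... | false = λ x → u-first (sgn rank τ w) (sgn rank τ u) x
  where
  u-first : ∀ a b x → a * (b * x) ≡ - (b * (- a * x))
  u-first = solve-∀

x≡-x⇒x≡0 : ∀ x → x ≡ - x → x ≡ 0ℤ
x≡-x⇒x≡0 +0       _  = refl
x≡-x⇒x≡0 +[1+ n ] ()
x≡-x⇒x≡0 -[1+ n ] ()

if-*-∑ : ∀ b a (g : Fin n → ℤ) → (if b then 0ℤ else a * ∑ g) ≡ ∑ (λ i → if b then 0ℤ else a * g i)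
if-*-∑ {n} true  a g = sym (∑-zero {n} λ _ → refl)
if-*-∑ false a g = *-distribˡ-∑ a g

∂∘∂ : ∀ {rank : Fin n → ℕ} → Injective _≡_ _≡_ rank → ∀ c τ → ∂ rank (∂ rank c) τ ≡ 0ℤ
∂∘∂ {n = n} {rank} inj c τ = trans ∂∂≡X (x≡-x⇒x≡0 X X≡-X)
  where
  F : Fin n → Fin n → ℤ
  F w u = if lookup τ w then 0ℤ else sgn rank τ w * ∂-term rank c (τ ∪ ⁅ w ⁆) u

  X : ℤ
  X = ∑ λ w → ∑ (F w)

  ∂∂≡X : ∂ rank (∂ rank c) τ ≡ X
  ∂∂≡X = ∑-cong λ w → if-*-∑ (lookup τ w) (sgn rank τ w) (∂-term rank c (τ ∪ ⁅ w ⁆))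

  F-antisym : ∀ w u → F w u ≡ - F u w
  F-antisym w u with w ≟ u
  ... | yes refl rewrite lookup-p∪⁅x⁆-x τ w | ℤ.*-zeroʳ (sgn rank τ w) with lookup τ w
  ...   | true  = refl
  ...   | false = refl
  F-antisym w u | no w≢u
    rewrite lookup-p∪⁅x⁆-y τ (w≢u ∘ sym) | lookup-p∪⁅x⁆-y τ w≢u | ∪⁅x⁆∪⁅y⁆-comm τ u w
    with lookup τ w in τ[w] | lookup τ u in τ[u]
  ... | true  | true  = refl
  ... | true  | false = cong -_ (sym (ℤ.*-zeroʳ (sgn rank τ u)))
  ... | false | true  = ℤ.*-zeroʳ (sgn rank τ w)
  ... | false | false = sgn-swap rank τ w u (w≢u ∘ inj) τ[w] τ[u] (c ((τ ∪ ⁅ w ⁆) ∪ ⁅ u ⁆))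

  X≡-X : X ≡ - X
  X≡-X = begin
    ∑ (λ w → ∑ (F w))             ≡⟨ ∑-cong (λ w → ∑-cong (F-antisym w)) ⟩
    ∑ (λ w → ∑ (λ u → - F u w))   ≡⟨ ∑-cong (λ w → ∑-neg (λ u → F u w)) ⟩
    ∑ (λ w → - ∑ (λ u → F u w))   ≡⟨ ∑-neg (λ w → ∑ (λ u → F u w)) ⟩
    - ∑ (λ w → ∑ (λ u → F u w))   ≡⟨ cong -_ (sym (∑-comm F)) ⟩
    - ∑ (λ w → ∑ (F w))           ∎
    where open ≡-Reasoning

-- Cones and links at the last vertex

cone : Fin n → Chain n → Chain n
cone v c ρ = if lookup ρ v then c (ρ ∖ v) else 0ℤ

capLink-∋ : ∀ (γ : Chain n) v τ → lookup τ v ≡ true → capLink γ v τ ≡ 0ℤ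
capLink-∋ γ v τ = cong (if_then 0ℤ else γ (τ ∪ ⁅ v ⁆))

capLink-∌ : ∀ (γ : Chain n) v τ → lookup τ v ≡ false → capLink γ v τ ≡ γ (τ ∪ ⁅ v ⁆)
capLink-∌ γ v τ = cong (if_then 0ℤ else γ (τ ∪ ⁅ v ⁆))

cone-∋ : ∀ v (c : Chain n) τ → lookup τ v ≡ true → cone v c τ ≡ c (τ ∖ v)
cone-∋ v c τ = cong (if_then c (τ ∖ v) else 0ℤ)

cone-∌ : ∀ v (c : Chain n) τ → lookup τ v ≡ false → cone v c τ ≡ 0ℤ
cone-∌ v c τ = cong (if_then c (τ ∖ v) else 0ℤ)

capLink-∖ : ∀ (γ : Chain n) v σ → lookup σ v ≡ true → capLink γ v (σ ∖ v) ≡ γ σ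
capLink-∖ γ v σ v∈σ = trans (capLink-∌ γ v (σ ∖ v) (lookup-p∖x-x σ v)) (cong γ (p∖x∪⁅x⁆ σ v v∈σ))

capLink-≗0 : ∀ (c : Chain n) v → (∀ σ → c σ ≡ 0ℤ) → ∀ τ → capLink c v τ ≡ 0ℤ
capLink-≗0 c v c≗0 τ with lookup τ v
... | true  = refl
... | false = c≗0 (τ ∪ ⁅ v ⁆)

module LastVertex {n} (rank : Fin n → ℕ) (v : Fin n) (v-last : ∀ {u} → u ≢ v → rank u < rank v) where

  sgn-∪⁅v⁆ : ∀ τ {w} → lookup τ v ≡ false → w ≢ v → sgn rank (τ ∪ ⁅ v ⁆) w ≡ sgn rank τ w
  sgn-∪⁅v⁆ τ {w} v∉τ w≢v rewrite below-∪⁅⁆ rank τ v w v∉τ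
    with rank v <ᵇ rank w | <ᵇ-reflects-< (rank v) (rank w)
  ... | true  | ofʸ v<w = ⊥-elim (<-asym v<w (v-last w≢v))
  ... | false | _       = refl

  ∂-capLink : ∀ γ τ → ∂ rank (capLink γ v) τ ≡ capLink (∂ rank γ) v τ
  ∂-capLink γ τ with lookup τ v in τ[v]
  ... | true  = ∑-zero term
    where
    term : ∀ w → ∂-term rank (capLink γ v) τ w ≡ 0ℤ
    term w with lookup τ w
    ... | true  = refl
    ... | false = trans (cong (sgn rank τ w *_) (capLink-∋ γ v (τ ∪ ⁅ w ⁆) (lookup-p∪⁅x⁆-mono τ w τ[v])))
                        (ℤ.*-zeroʳ (sgn rank τ w))
  ... | false = ∑-cong term
    where
    term : ∀ w → ∂-term rank (capLink γ v) τ w ≡ ∂-term rank γ (τ ∪ ⁅ v ⁆) w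
    term w with w ≟ v
    ... | yes refl rewrite τ[v] | lookup-p∪⁅x⁆-x τ v = ℤ.*-zeroʳ (sgn rank τ v)
    ... | no w≢v rewrite lookup-p∪⁅x⁆-y τ w≢v with lookup τ w
    ...   | true  = refl
    ...   | false = cong₂ _*_ (sym (sgn-∪⁅v⁆ τ τ[v] w≢v))
                      (trans (capLink-∌ γ v (τ ∪ ⁅ w ⁆) (trans (lookup-p∪⁅x⁆-y τ (w≢v ∘ sym)) τ[v]))
                             (cong γ (∪⁅x⁆∪⁅y⁆-comm τ w v)))

  ∂-cone : ∀ c → (∀ σ → lookup σ v ≡ true → c σ ≡ 0ℤ) →
           ∀ σ → ∂ rank (cone v c) σ ≡ cone v (∂ rank c) σ + sgn rank σ v * c σ
  ∂-cone c c-avoids-v σ with lookup σ v in σ[v]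
  ... | true = begin
    ∂ rank (cone v c) σ                    ≡⟨ ∑-cong term ⟩
    ∂ rank c (σ ∖ v)                       ≡⟨ sym (ℤ.+-identityʳ _) ⟩
    ∂ rank c (σ ∖ v) + 0ℤ                  ≡⟨ cong (∂ rank c (σ ∖ v) +_) (sym (ℤ.*-zeroʳ (sgn rank σ v))) ⟩
    ∂ rank c (σ ∖ v) + sgn rank σ v * 0ℤ   ≡⟨ cong (λ x → ∂ rank c (σ ∖ v) + sgn rank σ v * x)
                                                   (sym (c-avoids-v σ σ[v])) ⟩
    ∂ rank c (σ ∖ v) + sgn rank σ v * c σ  ∎
    where
    open ≡-Reasoning
    σ∖v∪⁅v⁆ : (σ ∖ v) ∪ ⁅ v ⁆ ≡ σ
    σ∖v∪⁅v⁆ = p∖x∪⁅x⁆ σ v σ[v]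
    term : ∀ w → ∂-term rank (cone v c) σ w ≡ ∂-term rank c (σ ∖ v) w
    term w with w ≟ v
    ... | yes refl rewrite σ[v] | lookup-p∖x-x σ w =
      sym (trans (cong (sgn rank (σ ∖ w) w *_) (trans (cong c σ∖v∪⁅v⁆) (c-avoids-v σ σ[v])))
                 (ℤ.*-zeroʳ (sgn rank (σ ∖ w) w)))
    ... | no w≢v rewrite lookup-p∖x-y σ w≢v with lookup σ w
    ...   | true  = refl
    ...   | false = cong₂ _*_
      (trans (cong (λ ρ → sgn rank ρ w) (sym σ∖v∪⁅v⁆)) (sgn-∪⁅v⁆ (σ ∖ v) (lookup-p∖x-x σ v) w≢v))
      (trans (cone-∋ v c (σ ∪ ⁅ w ⁆) (lookup-p∪⁅x⁆-mono σ w σ[v])) (cong c (p∪⁅y⁆∖x w≢v)))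
  ... | false = trans (∑-single v off) (trans at (sym (ℤ.+-identityˡ _)))
    where
    off : ∀ w → w ≢ v → ∂-term rank (cone v c) σ w ≡ 0ℤ
    off w w≢v with lookup σ w
    ... | true  = refl
    ... | false = trans (cong (sgn rank σ w *_) (cone-∌ v c (σ ∪ ⁅ w ⁆) v∉σ∪⁅w⁆)) (ℤ.*-zeroʳ (sgn rank σ w))
      where
      v∉σ∪⁅w⁆ : lookup (σ ∪ ⁅ w ⁆) v ≡ false
      v∉σ∪⁅w⁆ = trans (lookup-p∪⁅x⁆-y σ (w≢v ∘ sym)) σ[v]
    at : ∂-term rank (cone v c) σ v ≡ sgn rank σ v * c σ
    at rewrite σ[v] = cong (sgn rank σ v *_)
                       (trans (cone-∋ v c (σ ∪ ⁅ v ⁆) (lookup-p∪⁅x⁆-x σ v)) (cong c (p∪⁅x⁆∖x σ v σ[v])))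

true≢false : true ≢ false
true≢false ()

∈⇒lookup≡true : x ∈ p → lookup p x ≡ true
∈⇒lookup≡true = []=⇒lookup

lookup≡true⇒∈ : lookup p x ≡ true → x ∈ p
lookup≡true⇒∈ {p = p} {x} = lookup⇒[]= x p

lookup≡false⇒∉ : lookup p x ≡ false → x ∉ p
lookup≡false⇒∉ x∉p x∈p = true≢false (trans (sym (∈⇒lookup≡true x∈p)) x∉p)

allSubsets-complete : ∀ (σ : Subset n) → σ List.∈ allSubsets
allSubsets-complete []          = here refl
allSubsets-complete (true ∷ σ)  = ∈-++⁺ˡ (∈-map⁺ (true ∷_) (allSubsets-complete σ))
allSubsets-complete (false ∷ σ) = ∈-++⁺ʳ _ (∈-map⁺ (false ∷_) (allSubsets-complete σ))

⊆-vsupp : ∀ (c : Chain n) → ¬ c σ ≡ 0ℤ → σ ⊆ vsupp c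
⊆-vsupp {σ = σ} c cσ≢0 {x} x∈σ =
  lookup≡true⇒∈ (trans (lookup∘tabulate _ x)
                       (Equivalence.to T-≡ (any⁺ _ (List.lose (allSubsets-complete σ) σ-witness))))
  where
  σ-witness : T (lookup σ x ∧ not (does (c σ ℤ.≟ 0ℤ)))
  σ-witness = Equivalence.from T-∧ (Equivalence.from T-≡ (∈⇒lookup≡true x∈σ) ,
                                    Equivalence.from T-not-≡ (dec-false (c σ ℤ.≟ 0ℤ) cσ≢0))

vsupp-witness : ∀ (c : Chain n) → x ∈ vsupp c → ∃ λ σ → x ∈ σ × ¬ c σ ≡ 0ℤ
vsupp-witness {x = x} c x∈vsupp
  with satisfied (any⁻ _ allSubsets
         (Equivalence.from T-≡ (trans (sym (lookup∘tabulate _ x)) (∈⇒lookup≡true x∈vsupp))))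
... | σ , witness = let (x∈σ , cσ≢0) = Equivalence.to T-∧ witness in
  σ , lookup≡true⇒∈ (Equivalence.to T-≡ x∈σ) , λ cσ≡0 → true≢false
    (trans (sym (dec-true (c σ ℤ.≟ 0ℤ) cσ≡0)) (Equivalence.to T-not-≡ cσ≢0))

IsChain-mono : (∀ {σ} → K σ → K′ σ) → IsChain K k c → IsChain K′ k c
IsChain-mono K⊆K′ c-chain σ cσ≢0 = let (Kσ , size) = c-chain σ cσ≢0 in K⊆K′ Kσ , size

IsChain-neg : IsChain K k c → IsChain K k (λ σ → - c σ)
IsChain-neg c-chain σ -cσ≢0 = c-chain σ λ cσ≡0 → -cσ≢0 (cong -_ cσ≡0)

IsChain-vsupp : IsChain K k c → IsChain (λ σ → K σ × σ ⊆ vsupp c) k c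
IsChain-vsupp {c = c} c-chain σ cσ≢0 = let (Kσ , size) = c-chain σ cσ≢0 in (Kσ , ⊆-vsupp c cσ≢0) , size

link-chain-avoids : ∀ {v} → IsChain (link K v) k c → ∀ σ → lookup σ v ≡ true → c σ ≡ 0ℤ
link-chain-avoids {c = c} {v} c-chain σ v∈σ =
  decidable-stable (c σ ℤ.≟ 0ℤ) λ cσ≢0 → proj₁ (proj₁ (c-chain σ cσ≢0)) (lookup≡true⇒∈ v∈σ)

cone-IsChain : ∀ {v} → IsChain (link K v) k c → IsChain K (suc k) (cone v c)
cone-IsChain {K = K} {v = v} c-chain ρ coneρ≢0 with lookup ρ v in ρ[v]
... | false = ⊥-elim (coneρ≢0 refl)
... | true  = let ((_ , Kρ) , size) = c-chain (ρ ∖ v) coneρ≢0 in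
  subst K (p∖x∪⁅x⁆ ρ v ρ[v]) Kρ ,
  trans (cong ∣_∣ (sym (p∖x∪⁅x⁆ ρ v ρ[v]))) (trans (∣p∪⁅x⁆∣ (ρ ∖ v) v (lookup-p∖x-x ρ v)) (cong suc size))

capLink-IsChain : ∀ {v} → IsChain K (suc k) c → IsChain (link K v) k (capLink c v)
capLink-IsChain {v = v} c-chain σ capσ≢0 with lookup σ v in σ[v]
... | true  = ⊥-elim (capσ≢0 refl)
... | false = let (Kσ∪v , size) = c-chain (σ ∪ ⁅ v ⁆) capσ≢0 in
  (lookup≡false⇒∉ σ[v] , Kσ∪v) , suc-injective (trans (sym (∣p∪⁅x⁆∣ σ v σ[v])) size)

-- Coning off a boundary of γ ∩ lk(v)

module LinkOfCycle {n} (Δ : SimplicialComplex n) (rank : Fin n → ℕ) (rank-injective : Injective _≡_ _≡_ rank)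
  (v : Fin n) (v-last : ∀ {u} → u ≢ v → rank u < rank v)
  {k} (γ : Chain n) (γ-cycle : IsCycle rank (face Δ) (suc k) γ) where

  open LastVertex rank v v-last

  capLink-IsCycle : IsCycle rank (link (induced Δ (vsupp γ)) v) k (capLink γ v)
  capLink-IsCycle = capLink-IsChain (IsChain-vsupp (proj₁ γ-cycle)) ,
                    λ τ → trans (∂-capLink γ τ) (capLink-≗0 (∂ rank γ) v (proj₂ γ-cycle) τ)

  module ConeOff (d : Chain n) (d-chain : IsChain (link (induced Δ (vsupp γ)) v) (suc k) d)
                 (∂d≡capLink : ∀ τ → ∂ rank d τ ≡ capLink γ v τ) where

    -d : Chain n
    -d σ = - d σ

    D γ′ : Chain n
    D = cone v -d
    γ′ σ = γ σ + ∂ rank D σ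

    d-avoids-v : ∀ σ → lookup σ v ≡ true → d σ ≡ 0ℤ
    d-avoids-v = link-chain-avoids {K = induced Δ (vsupp γ)} d-chain

    D-chain : IsChain (face Δ) (suc (suc k)) D
    D-chain = cone-IsChain (IsChain-neg (IsChain-mono (λ (v∉σ , Δσ∪v , _) → v∉σ , Δσ∪v) d-chain))

    ∂D≡γ′-γ : ∀ τ → ∂ rank D τ ≡ γ′ τ - γ τ
    ∂D≡γ′-γ τ = m≡n+m-n (∂ rank D τ) (γ τ)
      where
      m≡n+m-n : ∀ m n → m ≡ (n + m) - n
      m≡n+m-n = solve-∀

    γ′-closed : ∀ τ → ∂ rank γ′ τ ≡ 0ℤ
    γ′-closed τ = trans (∂-+ rank γ (∂ rank D) τ) (cong₂ _+_ (proj₂ γ-cycle τ) (∂∘∂ rank-injective D τ))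

    ∂D : ∀ σ → ∂ rank D σ ≡ cone v (∂ rank -d) σ + sgn rank σ v * -d σ
    ∂D = ∂-cone -d λ σ v∈σ → cong -_ (d-avoids-v σ v∈σ)

    γ′-∋ : ∀ σ → lookup σ v ≡ true → γ′ σ ≡ 0ℤ
    γ′-∋ σ v∈σ = begin
      γ σ + ∂ rank D σ
        ≡⟨ cong (γ σ +_) (∂D σ) ⟩
      γ σ + (cone v (∂ rank -d) σ + sgn rank σ v * -d σ)
        ≡⟨ cong₂ (λ a b → γ σ + (a + sgn rank σ v * - b)) (cone-∋ v (∂ rank -d) σ v∈σ) (d-avoids-v σ v∈σ) ⟩
      γ σ + (∂ rank -d (σ ∖ v) + sgn rank σ v * 0ℤ)
        ≡⟨ cong (λ a → γ σ + (a + sgn rank σ v * 0ℤ))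
                (trans (∂-neg rank d (σ ∖ v)) (cong -_ (∂d≡capLink (σ ∖ v)))) ⟩
      γ σ + (- capLink γ v (σ ∖ v) + sgn rank σ v * 0ℤ)
        ≡⟨ cong (λ a → γ σ + (- a + sgn rank σ v * 0ℤ)) (capLink-∖ γ v σ v∈σ) ⟩
      γ σ + (- γ σ + sgn rank σ v * 0ℤ)
        ≡⟨ cancel (γ σ) (sgn rank σ v) ⟩
      0ℤ ∎
      where
      open ≡-Reasoning
      cancel : ∀ a s → a + (- a + s * 0ℤ) ≡ 0ℤ
      cancel = solve-∀

    γ′-∌ : ∀ σ → lookup σ v ≡ false → γ′ σ ≡ γ σ + sgn rank σ v * -d σ
    γ′-∌ σ v∉σ = cong (γ σ +_) (trans (∂D σ)
      (trans (cong (_+ sgn rank σ v * -d σ) (cone-∌ v (∂ rank -d) σ v∉σ)) (ℤ.+-identityˡ _)))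

    γ′-support : ∀ {σ} → ¬ γ′ σ ≡ 0ℤ → lookup σ v ≡ false × (¬ γ σ ≡ 0ℤ ⊎ ¬ d σ ≡ 0ℤ)
    γ′-support {σ} γ′σ≢0 with lookup σ v in σ[v]
    ... | true = ⊥-elim (γ′σ≢0 (γ′-∋ σ σ[v]))
    ... | false with γ σ ℤ.≟ 0ℤ | d σ ℤ.≟ 0ℤ
    ...   | no γσ≢0  | _        = refl , inj₁ γσ≢0
    ...   | yes _    | no dσ≢0  = refl , inj₂ dσ≢0
    ...   | yes γσ≡0 | yes dσ≡0 = ⊥-elim (γ′σ≢0 (begin
      γ′ σ                        ≡⟨ γ′-∌ σ σ[v] ⟩
      γ σ + sgn rank σ v * - d σ  ≡⟨ cong₂ (λ a b → a + sgn rank σ v * - b) γσ≡0 dσ≡0 ⟩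
      0ℤ + sgn rank σ v * 0ℤ      ≡⟨ trans (ℤ.+-identityˡ _) (ℤ.*-zeroʳ (sgn rank σ v)) ⟩
      0ℤ                          ∎))
      where open ≡-Reasoning

    γ′-chain : IsChain (face Δ) (suc k) γ′
    γ′-chain σ γ′σ≢0 with γ′-support γ′σ≢0
    ... | _ , inj₁ γσ≢0 = proj₁ γ-cycle σ γσ≢0
    ... | _ , inj₂ dσ≢0 = let ((_ , Δσ∪v , _) , size) = d-chain σ dσ≢0 in
                          downClosed Δ (p⊆p∪q ⁅ v ⁆) Δσ∪v , size

    vsupp-γ′ : vsupp γ′ ⊆ vsupp γ ∖ v
    vsupp-γ′ {x} x∈vsuppγ′ with vsupp-witness γ′ x∈vsuppγ′
    ... | σ , x∈σ , γ′σ≢0 with γ′-support γ′σ≢0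
    ... | v∉σ , γσ≢0⊎dσ≢0 = x∈p∧x≢y⇒x∈p-y (x∈vsuppγ γσ≢0⊎dσ≢0) x≢v
      where
      x≢v : x ≢ v
      x≢v refl = lookup≡false⇒∉ v∉σ x∈σ
      x∈vsuppγ : ¬ γ σ ≡ 0ℤ ⊎ ¬ d σ ≡ 0ℤ → x ∈ vsupp γ
      x∈vsuppγ (inj₁ γσ≢0) = ⊆-vsupp γ γσ≢0 x∈σ
      x∈vsuppγ (inj₂ dσ≢0) = proj₂ (proj₂ (proj₁ (d-chain σ dσ≢0))) (p⊆p∪q ⁅ v ⁆ x∈σ)

  homologous-cycle-avoiding-v : IsBoundary rank (link (induced Δ (vsupp γ)) v) k (capLink γ v) →
    ∃ λ γ′ → IsCycle rank (face Δ) (suc k) γ′ × IsBoundary rank (face Δ) (suc k) (λ σ → γ′ σ - γ σ)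
           × vsupp γ′ ⊆ vsupp γ ∖ v
  homologous-cycle-avoiding-v (d , d-chain , ∂d≡capLink) =
    γ′ , (γ′-chain , γ′-closed) , (D , D-chain , ∂D≡γ′-γ) , vsupp-γ′
    where open ConeOff d d-chain ∂d≡capLink

lemma5p2 : (n : ℕ) (Δ : SimplicialComplex n) (k : ℕ) → 1 ≤ k →
    (rank : Fin n → ℕ) → Injective _≡_ _≡_ rank →
    (v : Fin n) → (∀ u → rank u ≤ rank v) →
    (γ : Chain n) → IsCycle rank (face Δ) k γ →
    ¬ IsBoundary rank (face Δ) k γ →
    (∀ γ′ → IsCycle rank (face Δ) k γ′ →
      IsBoundary rank (face Δ) k (λ σ → γ′ σ - γ σ) →
      ∣ vsupp γ ∣ ≤ ∣ vsupp γ′ ∣) →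
    v ∈ vsupp γ →
    IsCycle rank (link (induced Δ (vsupp γ)) v) (k ∸ 1) (capLink γ v) ×
    ¬ IsBoundary rank (link (induced Δ (vsupp γ)) v) (k ∸ 1) (capLink γ v)
lemma5p2 n Δ (suc k) _ rank rank-injective v v-top γ γ-cycle _ minimal v∈vsuppγ =
  capLink-IsCycle , λ capLink-bounds →
    let (γ′ , γ′-cycle , γ′∼γ , vsuppγ′⊆) = homologous-cycle-avoiding-v capLink-bounds in
    <⇒≱ (≤-<-trans (p⊆q⇒∣p∣≤∣q∣ vsuppγ′⊆) (x∈p⇒∣p-x∣<∣p∣ v∈vsuppγ)) (minimal γ′ γ′-cycle γ′∼γ)
  where
  v-last : ∀ {u} → u ≢ v → rank u < rank v
  v-last {u} u≢v = ≤∧≢⇒< (v-top u) (u≢v ∘ rank-injective)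
  open LinkOfCycle Δ rank rank-injective v v-last γ γ-cycle
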